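{- For all nonnegative integers $q$ and $n$, \[ \sum_{\substack{a_1+\cdots+a_{q+1}=n\\ a_i\ge0}}\frac{1}{\prod_{j=1}^{q}(a_j+a_{j+1}+\cdots+a_{q+1}+1)}=1, \] where the empty product (for $q=0$) is taken to be $1$.
   Context: The sum runs over all $(q+1)$-tuples of nonnegative integers $(a_1,\ldots,a_{q+1})$ with sum $n$. -}

module Defs where

open import Data.Nat using (ℕ; zero; suc; _+_; _∸_)
open import Data.Fin using (Fin; toℕ; inject₁)
open import Data.Vec using (Vec; []; _∷_; lookup; drop)
open import Data.List using (List; []; _∷_; concatMap; map; upTo)
open import Data.Rational using (ℚ; 1ℚ; 0ℚ; _/_)
open import Data.Rational as Q using ()
open import Data.Integer using (+_)
import Data.Vec as V

compositions : (k n : ℕ) → List (Vec ℕ k)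
compositions zero    zero    = [] ∷ []
compositions zero    (suc n) = []
compositions (suc k) n =
  concatMap (λ a → map (a ∷_) (compositions k (n ∸ a))) (upTo (suc n))

sumℚ : List ℚ → ℚ
sumℚ []       = 0ℚ
sumℚ (x ∷ xs) = x Q.+ sumℚ xs

prodℚ : List ℚ → ℚ
prodℚ []       = 1ℚ
prodℚ (x ∷ xs) = x Q.* prodℚ xs

tailSum : {m : ℕ} → Vec ℕ m → ℕ → ℕ
tailSum []       _       = 0
tailSum (a ∷ as) zero    = a + V.sum as
tailSum (a ∷ as) (suc j) = tailSum as j

-- The summand 1 / ∏_{j=1}^{q} (a_j + ⋯ + a_{q+1} + 1)
-- (j = 1..q corresponds to 0-indexed j = 0..q-1).
summand : (q : ℕ) → Vec ℕ (suc q) → ℚ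
summand q a =
  prodℚ (map (λ j → (+ 1) / suc (tailSum a j)) (upTo q))

module Submission where

-- Splitting off the first part a of a composition of n, the first
-- factor of the product is 1/(a + (n - a) + 1) = 1/(n + 1) whatever a is, and the
-- rest is the summand for q - 1 at a composition of n - a, whose sum is 1 by induction.
-- Hence the total is (n + 1) · 1/(n + 1) = 1. For q = 0 there is a single composition
-- and the product is empty.

open import Defs
open import Function using (_∘_; id)
open import Data.Nat using (ℕ; zero; suc; _∸_; _<_; _≤_)
import Data.Nat as ℕ
open import Data.Nat.Properties using (≤-pred; m+[n∸m]≡n; n∸n≡0; m<n⇒0<n∸m)
import Data.Nat.Coprimality as Coprimality
open import Data.List using (List; []; _∷_; _++_; [_]; map; concatMap; applyUpTo; upTo; length)
open import Data.List.Properties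
  using (map-++; map-∘; map-cong-local; length-applyUpTo; upTo-∷ʳ; concatMap-++)
open import Data.List.Relation.Unary.All as All using (All; []; _∷_)
open import Data.List.Relation.Unary.All.Properties using (map⁺; concat⁺; applyUpTo⁺₁)
open import Data.Vec using (Vec; []; _∷_)
import Data.Vec as V
open import Data.Integer using (1ℤ)
import Data.Integer as ℤ
import Data.Integer.Properties as ℤ
open import Data.Rational using (ℚ; mkℚ; 1ℚ; _/_; 1/_; _+_; _*_)
open import Data.Rational.Properties
  using (+-identityˡ; +-identityʳ; +-assoc; *-identityˡ; *-identityʳ; *-zeroʳ; *-zeroˡ;
         *-distribˡ-+; *-distribʳ-+; *-inverseʳ; normalize-coprime; toℚᵘ-injective; toℚᵘ-homo-+)
import Data.Rational.Unnormalised as ℚᵘ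
import Data.Rational.Unnormalised.Properties as ℚᵘ
open import Relation.Binary.PropositionalEquality using (_≡_; refl; sym; trans; cong; cong₂; module ≡-Reasoning)
open ≡-Reasoning

sumℚ-++ : (xs ys : List ℚ) → sumℚ (xs ++ ys) ≡ sumℚ xs + sumℚ ys
sumℚ-++ []       ys = sym (+-identityˡ (sumℚ ys))
sumℚ-++ (x ∷ xs) ys = trans (cong (x +_) (sumℚ-++ xs ys)) (sym (+-assoc x (sumℚ xs) (sumℚ ys)))

sumℚ-map-concatMap : {A B : Set} (f : B → ℚ) (g : A → List B) (xs : List A) →
  sumℚ (map f (concatMap g xs)) ≡ sumℚ (map (sumℚ ∘ map f ∘ g) xs)
sumℚ-map-concatMap f g []       = refl
sumℚ-map-concatMap f g (x ∷ xs) = begin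
  sumℚ (map f (g x ++ concatMap g xs))                 ≡⟨ cong sumℚ (map-++ f (g x) (concatMap g xs)) ⟩
  sumℚ (map f (g x) ++ map f (concatMap g xs))         ≡⟨ sumℚ-++ (map f (g x)) _ ⟩
  sumℚ (map f (g x)) + sumℚ (map f (concatMap g xs))   ≡⟨ cong (sumℚ (map f (g x)) +_) (sumℚ-map-concatMap f g xs) ⟩
  sumℚ (map f (g x)) + sumℚ (map (sumℚ ∘ map f ∘ g) xs) ∎

sumℚ-*ˡ : {A : Set} (c : ℚ) (f : A → ℚ) (xs : List A) →
  sumℚ (map (λ x → c * f x) xs) ≡ c * sumℚ (map f xs)
sumℚ-*ˡ c f []       = sym (*-zeroʳ c)
sumℚ-*ˡ c f (x ∷ xs) = trans (cong (c * f x +_) (sumℚ-*ˡ c f xs)) (sym (*-distribˡ-+ c (f x) _))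

fromℕ : ℕ → ℚ
fromℕ k = mkℚ (ℤ.+ k) 0 (Coprimality.sym (Coprimality.1-coprimeTo k))

fromℕ-suc : (k : ℕ) → fromℕ (suc k) ≡ 1ℚ + fromℕ k
fromℕ-suc k = toℚᵘ-injective (ℚᵘ.≃-sym (ℚᵘ.≃-trans (toℚᵘ-homo-+ 1ℚ (fromℕ k)) (ℚᵘ.*≡* cross)))
  where
  cross : (1ℤ ℤ.* 1ℤ ℤ.+ ℤ.+ k ℤ.* 1ℤ) ℤ.* 1ℤ ≡ ℤ.+ suc k ℤ.* (1ℤ ℤ.* 1ℤ)
  cross = begin
    (1ℤ ℤ.+ ℤ.+ k ℤ.* 1ℤ) ℤ.* 1ℤ  ≡⟨ ℤ.*-identityʳ _ ⟩
    1ℤ ℤ.+ ℤ.+ k ℤ.* 1ℤ           ≡⟨ cong (λ z → 1ℤ ℤ.+ z) (ℤ.*-identityʳ (ℤ.+ k)) ⟩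
    ℤ.+ suc k                     ≡⟨ sym (ℤ.*-identityʳ _) ⟩
    ℤ.+ suc k ℤ.* 1ℤ              ∎

sumℚ-const : {A : Set} (c : ℚ) (xs : List A) → sumℚ (map (λ _ → c) xs) ≡ fromℕ (length xs) * c
sumℚ-const c []       = sym (*-zeroˡ c)
sumℚ-const c (x ∷ xs) = begin
  c + sumℚ (map (λ _ → c) xs)       ≡⟨ cong₂ _+_ (sym (*-identityˡ c)) (sumℚ-const c xs) ⟩
  1ℚ * c + fromℕ (length xs) * c    ≡⟨ sym (*-distribʳ-+ c 1ℚ (fromℕ (length xs))) ⟩
  (1ℚ + fromℕ (length xs)) * c      ≡⟨ cong (_* c) (sym (fromℕ-suc (length xs))) ⟩
  fromℕ (suc (length xs)) * c       ∎

fromℕ-suc-*-1/suc : (n : ℕ) → fromℕ (suc n) * (1ℤ / suc n) ≡ 1ℚ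
fromℕ-suc-*-1/suc n = begin
  fromℕ (suc n) * (1ℤ / suc n)      ≡⟨ cong (fromℕ (suc n) *_) (normalize-coprime (Coprimality.1-coprimeTo (suc n))) ⟩
  fromℕ (suc n) * 1/ fromℕ (suc n)  ≡⟨ *-inverseʳ (fromℕ (suc n)) ⟩
  1ℚ                                ∎

map-applyUpTo : {A B : Set} (f : A → B) (g : ℕ → A) (n : ℕ) →
  map f (applyUpTo g n) ≡ applyUpTo (f ∘ g) n
map-applyUpTo f g zero    = refl
map-applyUpTo f g (suc n) = cong (f (g 0) ∷_) (map-applyUpTo f (g ∘ suc) n)

upTo-suc-≤ : (n : ℕ) → All (_≤ n) (upTo (suc n))
upTo-suc-≤ n = applyUpTo⁺₁ id (suc n) ≤-pred

compositions-sum : (k n : ℕ) → All (λ v → V.sum v ≡ n) (compositions k n)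
compositions-sum zero    zero    = refl ∷ []
compositions-sum zero    (suc n) = []
compositions-sum (suc k) n       = concat⁺ (map⁺ (All.map cons-sum (upTo-suc-≤ n)))
  where
  cons-sum : ∀ {a} → a ≤ n → All (λ v → V.sum v ≡ n) (map (a ∷_) (compositions k (n ∸ a)))
  cons-sum {a} a≤n =
    map⁺ (All.map (λ s → trans (cong (a ℕ.+_) s) (m+[n∸m]≡n a≤n)) (compositions-sum k (n ∸ a)))

concatMap-All-[] : {A B : Set} (f : A → List B) {xs : List A} →
  All (λ x → f x ≡ []) xs → concatMap f xs ≡ []
concatMap-All-[] f []         = refl
concatMap-All-[] f (e ∷ es) rewrite e = concatMap-All-[] f es

compositions-1 : (n : ℕ) → compositions 1 n ≡ [ n ∷ [] ]
compositions-1 n = begin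
  concatMap cons (upTo (suc n))                ≡⟨ cong (concatMap cons) (sym (upTo-∷ʳ n)) ⟩
  concatMap cons (upTo n ++ [ n ])             ≡⟨ concatMap-++ cons (upTo n) [ n ] ⟩
  concatMap cons (upTo n) ++ cons n ++ []      ≡⟨ cong₂ (λ xs ys → xs ++ ys ++ []) below-n at-n ⟩
  [ n ∷ [] ]                                   ∎
  where
  cons : ℕ → List (Vec ℕ 1)
  cons a = map (a ∷_) (compositions 0 (n ∸ a))

  compositions-0-pos : ∀ {m} → 0 < m → compositions 0 m ≡ []
  compositions-0-pos {suc m} _ = refl

  below-n : concatMap cons (upTo n) ≡ []
  below-n = concatMap-All-[] cons
    (applyUpTo⁺₁ id n (cong (map _) ∘ compositions-0-pos ∘ m<n⇒0<n∸m))

  at-n : cons n ≡ [ n ∷ [] ]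
  at-n = cong (map (n ∷_) ∘ compositions 0) (n∸n≡0 n)

summand-cons : (q a : ℕ) (v : Vec ℕ (suc q)) →
  summand (suc q) (a ∷ v) ≡ (1ℤ / suc (a ℕ.+ V.sum v)) * summand q v
summand-cons q a v = cong ((1ℤ / suc (a ℕ.+ V.sum v)) *_) (cong prodℚ (begin
  map factor (applyUpTo suc q)        ≡⟨ map-applyUpTo factor suc q ⟩
  applyUpTo (factor ∘ suc) q          ≡⟨ sym (map-applyUpTo (factor ∘ suc) id q) ⟩
  map (factor ∘ suc) (upTo q)         ∎))
  where
  factor : ℕ → ℚ
  factor j = 1ℤ / suc (tailSum (a ∷ v) j)

sumℚ-summand-cons : (q n a : ℕ) → a ≤ n →
  sumℚ (map (summand (suc q)) (map (a ∷_) (compositions (suc q) (n ∸ a))))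
    ≡ (1ℤ / suc n) * sumℚ (map (summand q) (compositions (suc q) (n ∸ a)))
sumℚ-summand-cons q n a a≤n = begin
  sumℚ (map (summand (suc q)) (map (a ∷_) vs))      ≡⟨ cong sumℚ (sym (map-∘ vs)) ⟩
  sumℚ (map (summand (suc q) ∘ (a ∷_)) vs)          ≡⟨ cong sumℚ (map-cong-local (All.map factor-out (compositions-sum (suc q) (n ∸ a)))) ⟩
  sumℚ (map (λ v → (1ℤ / suc n) * summand q v) vs)  ≡⟨ sumℚ-*ˡ (1ℤ / suc n) (summand q) vs ⟩
  (1ℤ / suc n) * sumℚ (map (summand q) vs)          ∎
  where
  vs : List (Vec ℕ (suc q))
  vs = compositions (suc q) (n ∸ a)

  factor-out : ∀ {v} → V.sum v ≡ n ∸ a → summand (suc q) (a ∷ v) ≡ (1ℤ / suc n) * summand q v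
  factor-out {v} s = trans (summand-cons q a v)
    (cong (λ m → (1ℤ / suc m) * summand q v) (trans (cong (a ℕ.+_) s) (m+[n∸m]≡n a≤n)))

proposition2p4 : (q n : ℕ) → sumℚ (map (summand q) (compositions (suc q) n)) ≡ 1ℚ
proposition2p4 zero    n = trans (cong (sumℚ ∘ map (summand 0)) (compositions-1 n)) (+-identityʳ 1ℚ)
proposition2p4 (suc q) n = begin
  sumℚ (map (summand (suc q)) (concatMap cons (upTo (suc n))))
    ≡⟨ sumℚ-map-concatMap (summand (suc q)) cons (upTo (suc n)) ⟩
  sumℚ (map (sumℚ ∘ map (summand (suc q)) ∘ cons) (upTo (suc n)))
    ≡⟨ cong sumℚ (map-cong-local (All.map fibre (upTo-suc-≤ n))) ⟩
  sumℚ (map (λ _ → 1ℤ / suc n) (upTo (suc n)))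
    ≡⟨ sumℚ-const (1ℤ / suc n) (upTo (suc n)) ⟩
  fromℕ (length (upTo (suc n))) * (1ℤ / suc n)
    ≡⟨ cong (λ k → fromℕ k * (1ℤ / suc n)) (length-applyUpTo id (suc n)) ⟩
  fromℕ (suc n) * (1ℤ / suc n)
    ≡⟨ fromℕ-suc-*-1/suc n ⟩
  1ℚ ∎
  where
  cons : ℕ → List (Vec ℕ (suc (suc q)))
  cons a = map (a ∷_) (compositions (suc q) (n ∸ a))

  fibre : ∀ {a} → a ≤ n → sumℚ (map (summand (suc q)) (cons a)) ≡ 1ℤ / suc n
  fibre {a} a≤n = trans (sumℚ-summand-cons q n a a≤n)
    (trans (cong ((1ℤ / suc n) *_) (proposition2p4 q (n ∸ a))) (*-identityʳ _))
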